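{- Let $\lambda\vdash m$ and let $L$ be the maximal number of parts of the descent composition of a standard tableau of shape $\lambda$. If $Skeleton(\lambda)_L$ has an edge between standard tableaux $S$ and $S'$, then the numbers of descents of $S$ and $S'$ differ by at most $1$.
   Context: Tableaux of shape $\lambda$: fillings of the Young diagram (English notation) by positive integers weakly increasing along rows, strictly increasing down columns; $SSYT(\lambda)_n$: those with entries $\le n$. Row reading word $rw(T)$: rows left to right, from bottom row to top row. Crystal operators on words over $\{1,\dots,n\}$, $1\le i\le n-1$: place ")" under each $i$ and "(" under each $i+1$, repeatedly delete a "(" immediately followed (among remaining symbols) by ")", leaving $)^{\varphi}(^{\varepsilon}$; $f_i$ changes the $i$ of the rightmost unmatched ")" into $i+1$ (undefined if $\varphi=0$). On tableaux: apply $f_i$ to $rw(T)$ and change the corresponding entry. Standardization $std(T)$ of $T$ of weight $\gamma$: replace entries $1$ left to right by $1,\dots,\gamma_1$, entries $2$ left to right by $\gamma_1+1,\dots,\gamma_1+\gamma_2$, etc. Descent of a standard $S$ with $m$ cells: $i$ with $i+1$ in a strictly lower row than $i$; with descents $d_1<\dots<d_k$, $DesComp(S)=(d_1,d_2-d_1,\dots,m-d_k)$. For standard $S$ of shape $\lambda$, $V^n_S=\{T\in SSYT(\lambda)_n: std(T)=S\}$. Skeleton: $Skeleton(\lambda)_n$ is the labelled directed graph whose vertices are the standard tableaux $S$ of shape $\lambda$ whose descent composition has at most $n$ parts, with, for each ordered pair $S\ne S'$ for which some $T\in V^n_S$ and some $i\in\{1,\dots,n-1\}$ satisfy $f_i(T)\in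 V^n_{S'}$, one edge $S\to S'$ labelled by the smallest such $i$. -}

module Defs where

open import Data.Nat using (ℕ; zero; suc; _+_; _∸_; _≤_; _<_; _≥_; _≡ᵇ_; _<ᵇ_; _<?_)
open import Data.Bool using (Bool; true; false; if_then_else_; _∧_; _∨_)
open import Data.List using (List; []; _∷_; map; length; concat; reverse; take; drop; zip; upTo; filter; filterᵇ; _++_; zipWith)
open import Data.Nat.ListAction using (sum)
open import Data.List.Relation.Unary.All using (All)
open import Data.List.Relation.Unary.Linked using (Linked)
open import Data.List.Relation.Binary.Permutation.Propositional using (_↭_)
open import Data.Maybe using (Maybe; just; nothing)
import Data.Maybe as Maybe
open import Data.Product using (_×_; _,_; ∃; ∃-syntax; proj₁; proj₂)
open import Relation.Binary.PropositionalEquality using (_≡_; _≢_)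

-- A tableau is a list of rows, top row first (English notation);
-- each row is listed left to right.
Tab : Set
Tab = List (List ℕ)

shapeOf : Tab → List ℕ
shapeOf T = map length T

IsPartition : ℕ → List ℕ → Set
IsPartition m sh = Linked _≥_ sh × All (λ k → 1 ≤ k) sh × sum sh ≡ m

ColStrict : List ℕ → List ℕ → Set
ColStrict r1 r2 = length r2 ≤ length r1 × All (λ p → proj₁ p < proj₂ p) (zip r1 r2)

IsSSYT : List ℕ → ℕ → Tab → Set
IsSSYT sh n T =
  shapeOf T ≡ sh × All (All (λ x → 1 ≤ x × x ≤ n)) T × All (Linked _≤_) T × Linked ColStrict T

IsStandard : List ℕ → Tab → Set
IsStandard sh S =
  shapeOf S ≡ sh × All (Linked _<_) S × Linked ColStrict S
  × concat S ↭ map suc (upTo (sum sh))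

cellsCV : Tab → List (ℕ × ℕ)
cellsCV T = concat (map (λ row → zip (upTo (length row)) row) T)

stdLabel : Tab → ℕ → ℕ → ℕ
stdLabel T c v = suc (length (filterᵇ
  (λ p → (proj₂ p <ᵇ v) ∨ ((proj₂ p ≡ᵇ v) ∧ (proj₁ p <ᵇ c))) (cellsCV T)))

std : Tab → Tab
std T = map (λ row → map (λ p → stdLabel T (proj₁ p) (proj₂ p)) (zip (upTo (length row)) row)) T

-- 0-based index (from the top) of the first row containing k
rowOf : ℕ → Tab → ℕ
rowOf k [] = 0
rowOf k (r ∷ rs) = if anyEq r then 0 else suc (rowOf k rs)
  where
  anyEq : List ℕ → Bool
  anyEq [] = false
  anyEq (x ∷ xs) = (x ≡ᵇ k) ∨ anyEq xs

cellCount : Tab → ℕ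
cellCount S = length (concat S)

descents : Tab → List ℕ
descents S = filter (λ i → rowOf i S <? rowOf (suc i) S) (map suc (upTo (cellCount S ∸ 1)))

desComp : Tab → List ℕ
desComp S = zipWith _∸_ (descents S ++ (cellCount S ∷ [])) (0 ∷ descents S)

numDes : Tab → ℕ
numDes S = length (descents S)

-- marks the unmatched i's (the ")" left after bracket cancellation);
-- `o` = number of currently unmatched "(" (i.e. i+1's) seen so far
unmatchedMarks : ℕ → ℕ → List ℕ → List Bool
unmatchedMarks i o [] = []
unmatchedMarks i o (x ∷ w) =
  if x ≡ᵇ i
  then (matchStep o)
  else (if x ≡ᵇ suc i then false ∷ unmatchedMarks i (suc o) w
        else false ∷ unmatchedMarks i o w)
  where
  matchStep : ℕ → List Bool
  matchStep zero = true ∷ unmatchedMarks i zero w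
  matchStep (suc o') = false ∷ unmatchedMarks i o' w

incFirstMarked : List Bool → List ℕ → Maybe (List ℕ)
incFirstMarked (true ∷ bs) (x ∷ xs) = just (suc x ∷ xs)
incFirstMarked (false ∷ bs) (x ∷ xs) = Maybe.map (x ∷_) (incFirstMarked bs xs)
incFirstMarked _ _ = nothing

-- f_i on words: change the rightmost unmatched i into i+1
fWord : ℕ → List ℕ → Maybe (List ℕ)
fWord i w = Maybe.map reverse (incFirstMarked (reverse (unmatchedMarks i 0 w)) (reverse w))

-- row reading word: rows left to right, from bottom row to top row
rw : Tab → List ℕ
rw T = concat (reverse T)

splitBy : List ℕ → List ℕ → List (List ℕ)
splitBy [] w = []
splitBy (k ∷ ks) w = take k w ∷ splitBy ks (drop k w)

fTab : ℕ → Tab → Maybe Tab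
fTab i T = Maybe.map (λ w → reverse (splitBy (reverse (shapeOf T)) w)) (fWord i (rw T))

IsVertex : List ℕ → ℕ → Tab → Set
IsVertex sh n S = IsStandard sh S × length (desComp S) ≤ n

-- an edge S → S' exists in Skeleton(sh)_n (the label is irrelevant here)
SkeletonEdge : List ℕ → ℕ → Tab → Tab → Set
SkeletonEdge sh n S S' =
  IsVertex sh n S × IsVertex sh n S' × S ≢ S' ×
  ∃[ T ] ∃[ i ] (1 ≤ i × i < n × IsSSYT sh n T × std T ≡ S ×
    ∃[ T' ] (fTab i T ≡ just T' × IsSSYT sh n T' × std T' ≡ S'))

IsMaxDesParts : List ℕ → ℕ → Set
IsMaxDesParts sh L =
  (∃[ S ] (IsStandard sh S × length (desComp S) ≡ L))
  × (∀ S → IsStandard sh S → length (desComp S) ≤ L)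

-- For a tableau T whose standardization is standard, the descents of std T are
-- the ascents of the sequence of rows of the cells of T listed in
-- standardization order. The crystal operator
-- f_i changes a single entry, so T and f_i T have the same cells except one.
-- Deleting that cell from either tableau yields the same row sequence, obtained
-- from each of the two sequences by deleting one term, and deleting a term
-- changes the number of ascents by at most one.
module Submission where

open import Defs
open import Data.Nat using (ℕ; _≤_; _+_)
open import Data.List using (List)
open import Data.Product using (_×_)
open import Data.Sum using (_⊎_)

open import Data.Bool using (Bool; true; false; if_then_else_; T)
open import Data.Empty using (⊥-elim)
open import Data.Maybe using (just)
open import Data.Nat using (zero; suc; pred; _<_; _∸_; _≡ᵇ_; _<ᵇ_; z≤n; s≤s; s≤s⁻¹; z<s)
open import Data.Nat.Properties
open import Data.Nat.ListAction using (sum)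
open import Data.List using ([]; _∷_; _++_; [_]; map; length; concat; reverse; filter; filterᵇ; upTo; applyUpTo; zip; take; drop)
open import Data.List.Properties
open import Data.List.Membership.Propositional using (_∈_)
open import Data.List.Membership.Propositional.Properties using (∈-∃++; ∈-map⁺; ∈-++⁺ˡ; ∈-++⁺ʳ; ∈-++⁻)
open import Data.List.Relation.Unary.Any using (here; there)
import Data.List.Relation.Unary.All as All
open import Data.List.Relation.Unary.AllPairs using (_∷_)
open import Data.List.Relation.Unary.Unique.Propositional using (Unique)
import Data.List.Relation.Unary.Unique.Propositional.Properties as Unique
open import Data.List.Relation.Binary.Permutation.Propositional using (_↭_; ↭-sym; ↭⇒↭ₛ)
open import Data.List.Relation.Binary.Permutation.Propositional.Properties
  using (shift; ↭-length; ∈-resp-↭) renaming (map⁺ to ↭-map⁺)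
open import Data.List.Relation.Binary.Sublist.Propositional using (⊆-refl)
open import Data.List.Relation.Binary.Sublist.Propositional.Properties using (filter⁺)
open import Data.List.Relation.Binary.Sublist.Heterogeneous.Properties using (length-mono-≤)
open import Data.Product using (_,_; proj₁; proj₂; ∃-syntax; swap)
open import Data.Product.Relation.Binary.Lex.Strict using (×-Lex; ×-decidable; ×-transitive; ×-irreflexive; ×-compare)
open import Data.Sum using (inj₁; inj₂; [_,_]′)
open import Data.Unit using (⊤; tt)
open import Function using (_∘_; _on_)
open import Relation.Nullary using (¬_; Dec; yes; no; does; contradiction)
open import Relation.Nullary.Reflects using (ofʸ; ofⁿ)
open import Relation.Nullary.Decidable using (dec-true; dec-false)
open import Relation.Binary.Definitions using (tri<; tri≈; tri>)
open import Relation.Binary.PropositionalEquality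
  using (_≡_; _≢_; refl; sym; trans; cong; cong₂; subst; subst₂; isEquivalence; setoid; module ≡-Reasoning)
open import Data.List.Relation.Binary.Permutation.Setoid.Properties (setoid ℕ) using (Unique-resp-↭)

range : ℕ → ℕ → List ℕ
range s zero    = []
range s (suc n) = s ∷ range (suc s) n

map-suc-range : ∀ s n → map suc (range s n) ≡ range (suc s) n
map-suc-range s zero    = refl
map-suc-range s (suc n) = cong (suc s ∷_) (map-suc-range (suc s) n)

applyUpTo-range : ∀ {A : Set} (f : ℕ → A) n → applyUpTo f n ≡ map f (range 0 n)
applyUpTo-range f zero    = refl
applyUpTo-range f (suc n) = cong (f 0 ∷_) (begin
  applyUpTo (f ∘ suc) n        ≡⟨ applyUpTo-range (f ∘ suc) n ⟩
  map (f ∘ suc) (range 0 n)    ≡⟨ map-∘ (range 0 n) ⟩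
  map f (map suc (range 0 n))  ≡⟨ cong (map f) (map-suc-range 0 n) ⟩
  map f (range 1 n)            ∎)
  where open ≡-Reasoning

map-suc-upTo : ∀ n → map suc (upTo n) ≡ range 1 n
map-suc-upTo n = trans (map-upTo suc n) (trans (applyUpTo-range suc n) (map-suc-range 0 n))

range-++ : ∀ s i j → range s (i + j) ≡ range s i ++ range (s + i) j
range-++ s zero    j = cong (λ t → range t j) (sym (+-identityʳ s))
range-++ s (suc i) j = cong (s ∷_) (trans (range-++ (suc s) i j) (cong (λ t → range (suc s) i ++ range t j) (sym (+-suc s i))))

∈-range⁻ : ∀ {k} s n → k ∈ range s n → s ≤ k × k < s + n
∈-range⁻ s (suc n) (here refl) = ≤-refl , m<m+n s z<s
∈-range⁻ {k} s (suc n) (there k∈) with s<k , k<s+n ← ∈-range⁻ (suc s) n k∈ =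
  <⇒≤ s<k , subst (k <_) (sym (+-suc s n)) k<s+n

ascent : ℕ → ℕ → ℕ
ascent x y = if x <ᵇ y then 1 else 0

ascents : List ℕ → ℕ
ascents []          = 0
ascents (x ∷ [])    = 0
ascents (x ∷ y ∷ l) = ascent x y + ascents (y ∷ l)

ascent≤1 : ∀ x y → ascent x y ≤ 1
ascent≤1 x y with x <ᵇ y
... | true  = ≤-refl
... | false = z≤n

ascent-≤-ascent+ascent : ∀ x y z → ascent x z ≤ ascent x y + ascent y z
ascent-≤-ascent+ascent x y z with x <ᵇ z | <ᵇ-reflects-< x z | x <ᵇ y | <ᵇ-reflects-< x y | y <ᵇ z | <ᵇ-reflects-< y z
... | false | _       | _     | _        | _     | _        = z≤n
... | true  | _       | true  | _        | _     | _        = s≤s z≤n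
... | true  | _       | false | _        | true  | _        = s≤s z≤n
... | true  | ofʸ x<z | false | ofⁿ x≮y | false | ofⁿ y≮z = contradiction (<-≤-trans x<z (≤-trans (≮⇒≥ y≮z) (≮⇒≥ x≮y))) (<-irrefl refl)

ascent+ascent-≤-1+ascent : ∀ x y z → ascent x y + ascent y z ≤ suc (ascent x z)
ascent+ascent-≤-1+ascent x y z with x <ᵇ z | <ᵇ-reflects-< x z | x <ᵇ y | <ᵇ-reflects-< x y | y <ᵇ z | <ᵇ-reflects-< y z
... | true  | _        | true  | _       | true  | _       = ≤-refl
... | true  | _        | true  | _       | false | _       = s≤s z≤n
... | true  | _        | false | _       | true  | _       = s≤s z≤n
... | true  | _        | false | _       | false | _       = z≤n
... | false | _        | false | _       | true  | _       = ≤-refl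
... | false | _        | false | _       | false | _       = z≤n
... | false | _        | true  | _       | false | _       = ≤-refl
... | false | ofⁿ x≮z  | true  | ofʸ x<y | true  | ofʸ y<z = contradiction (<-trans x<y y<z) x≮z

ascents-insert-≥ : ∀ xs z ys → ascents (xs ++ ys) ≤ ascents (xs ++ z ∷ ys)
ascents-insert-≥ []           z []       = z≤n
ascents-insert-≥ []           z (y ∷ ys) = m≤n+m _ _
ascents-insert-≥ (x ∷ [])     z []       = z≤n
ascents-insert-≥ (x ∷ [])     z (y ∷ ys) = begin
  ascent x y + ascents (y ∷ ys)                ≤⟨ +-monoˡ-≤ _ (ascent-≤-ascent+ascent x z y) ⟩
  (ascent x z + ascent z y) + ascents (y ∷ ys) ≡⟨ +-assoc (ascent x z) _ _ ⟩
  ascent x z + (ascent z y + ascents (y ∷ ys)) ∎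
  where open ≤-Reasoning
ascents-insert-≥ (x ∷ x′ ∷ xs) z ys = +-monoʳ-≤ (ascent x x′) (ascents-insert-≥ (x′ ∷ xs) z ys)

ascents-insert-≤ : ∀ xs z ys → ascents (xs ++ z ∷ ys) ≤ suc (ascents (xs ++ ys))
ascents-insert-≤ []           z []       = z≤n
ascents-insert-≤ []           z (y ∷ ys) = +-monoˡ-≤ _ (ascent≤1 z y)
ascents-insert-≤ (x ∷ [])     z []       = subst (_≤ 1) (sym (+-identityʳ _)) (ascent≤1 x z)
ascents-insert-≤ (x ∷ [])     z (y ∷ ys) = begin
  ascent x z + (ascent z y + ascents (y ∷ ys)) ≡⟨ +-assoc (ascent x z) _ _ ⟨
  (ascent x z + ascent z y) + ascents (y ∷ ys) ≤⟨ +-monoˡ-≤ _ (ascent+ascent-≤-1+ascent x z y) ⟩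
  suc (ascent x y + ascents (y ∷ ys))          ∎
  where open ≤-Reasoning
ascents-insert-≤ (x ∷ x′ ∷ xs) z ys = begin
  ascent x x′ + ascents (x′ ∷ xs ++ z ∷ ys)      ≤⟨ +-monoʳ-≤ (ascent x x′) (ascents-insert-≤ (x′ ∷ xs) z ys) ⟩
  ascent x x′ + suc (ascents (x′ ∷ xs ++ ys))    ≡⟨ +-suc (ascent x x′) _ ⟩
  suc (ascent x x′ + ascents (x′ ∷ xs ++ ys))    ∎
  where open ≤-Reasoning

length-filter-ascents : ∀ (f : ℕ → ℕ) s n →
  length (filter (λ i → f i <? f (suc i)) (range s n)) ≡ ascents (map f (range s (suc n)))
length-filter-ascents f s zero    = refl
length-filter-ascents f s (suc n) with f s <ᵇ f (suc s)
... | true  = cong suc (length-filter-ascents f (suc s) n)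
... | false = length-filter-ascents f (suc s) n

numDes≡ascents : ∀ S → numDes S ≡ ascents (map (λ k → rowOf k S) (range 1 (cellCount S)))
numDes≡ascents S with cellCount S
... | zero  = refl
... | suc n = trans (cong (λ l → length (filter (λ i → rowOf i S <? rowOf (suc i) S) l)) (map-suc-upTo n))
                    (length-filter-ascents (λ k → rowOf k S) 1 n)

data ReplaceOne {A : Set} (_∼_ : A → A → Set) : List A → List A → Set where
  here  : ∀ {x y xs} → x ∼ y → ReplaceOne _∼_ (x ∷ xs) (y ∷ xs)
  there : ∀ {z xs ys} → ReplaceOne _∼_ xs ys → ReplaceOne _∼_ (z ∷ xs) (z ∷ ys)

_≈₁_ : {A : Set} → List A → List A → Set
_≈₁_ = ReplaceOne (λ _ _ → ⊤)

module _ {A : Set} {_∼_ : A → A → Set} where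

  replaceOne⁻ : ∀ {xs ys} → ReplaceOne _∼_ xs ys →
    ∃[ P ] ∃[ x ] ∃[ y ] ∃[ Q ] (xs ≡ P ++ x ∷ Q × ys ≡ P ++ y ∷ Q × x ∼ y)
  replaceOne⁻ (here {x} {y} {xs} x∼y) = [] , x , y , xs , refl , refl , x∼y
  replaceOne⁻ (there {z} r) with P , x , y , Q , refl , refl , x∼y ← replaceOne⁻ r =
    z ∷ P , x , y , Q , refl , refl , x∼y

  replaceOne⁺ : ∀ P {x y} Q → x ∼ y → ReplaceOne _∼_ (P ++ x ∷ Q) (P ++ y ∷ Q)
  replaceOne⁺ []      Q x∼y = here x∼y
  replaceOne⁺ (p ∷ P) Q x∼y = there (replaceOne⁺ P Q x∼y)

  replaceOne-reverse : ∀ {xs ys} → ReplaceOne _∼_ xs ys → ReplaceOne _∼_ (reverse xs) (reverse ys)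
  replaceOne-reverse r with P , x , y , Q , refl , refl , x∼y ← replaceOne⁻ r =
    subst₂ (ReplaceOne _∼_) (sym (reverse-mid P x Q)) (sym (reverse-mid P y Q)) (replaceOne⁺ (reverse Q) (reverse P) x∼y)
    where
    reverse-mid : ∀ P (x : A) Q → reverse (P ++ x ∷ Q) ≡ reverse Q ++ x ∷ reverse P
    reverse-mid P x Q = begin
      reverse (P ++ x ∷ Q)            ≡⟨ reverse-++ P (x ∷ Q) ⟩
      reverse (x ∷ Q) ++ reverse P    ≡⟨ cong (_++ reverse P) (unfold-reverse x Q) ⟩
      (reverse Q ++ [ x ]) ++ reverse P ≡⟨ ++-assoc (reverse Q) [ x ] (reverse P) ⟩
      reverse Q ++ x ∷ reverse P      ∎
      where open ≡-Reasoning

  replaceOne-++ˡ : ∀ {xs ys} zs → ReplaceOne _∼_ xs ys → ReplaceOne _∼_ (xs ++ zs) (ys ++ zs)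
  replaceOne-++ˡ zs (here x∼y) = here x∼y
  replaceOne-++ˡ zs (there r)  = there (replaceOne-++ˡ zs r)

  replaceOne-++ʳ : ∀ {xs ys} zs → ReplaceOne _∼_ xs ys → ReplaceOne _∼_ (zs ++ xs) (zs ++ ys)
  replaceOne-++ʳ []       r = r
  replaceOne-++ʳ (z ∷ zs) r = there (replaceOne-++ʳ zs r)

  replaceOne-++⁻ : ∀ xs ys {zs} → ReplaceOne _∼_ (xs ++ ys) zs →
    (∃[ xs′ ] (ReplaceOne _∼_ xs xs′ × zs ≡ xs′ ++ ys)) ⊎ (∃[ ys′ ] (ReplaceOne _∼_ ys ys′ × zs ≡ xs ++ ys′))
  replaceOne-++⁻ []       ys r = inj₂ (_ , r , refl)
  replaceOne-++⁻ (x ∷ xs) ys (here {y = y} x∼y) = inj₁ (y ∷ xs , here x∼y , refl)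
  replaceOne-++⁻ (x ∷ xs) ys (there r) with replaceOne-++⁻ xs ys r
  ... | inj₁ (xs′ , r′ , refl) = inj₁ (x ∷ xs′ , there r′ , refl)
  ... | inj₂ (ys′ , r′ , refl) = inj₂ (ys′ , r′ , refl)

  replaceOne⇒map≡ : ∀ {B : Set} (f : A → B) → (∀ {x y} → x ∼ y → f x ≡ f y) →
    ∀ {xs ys} → ReplaceOne _∼_ xs ys → map f xs ≡ map f ys
  replaceOne⇒map≡ f f-resp (here {xs = xs} x∼y) = cong (_∷ map f xs) (f-resp x∼y)
  replaceOne⇒map≡ f f-resp (there r)  = cong (_ ∷_) (replaceOne⇒map≡ f f-resp r)

replaceOne-length : ∀ {A : Set} {_∼_ : A → A → Set} {xs ys} → ReplaceOne _∼_ xs ys → length xs ≡ length ys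
replaceOne-length (here _)  = refl
replaceOne-length (there r) = cong suc (replaceOne-length r)

concat-replaceOne⁻ : ∀ {A : Set} (xss : List (List A)) {ws} → concat xss ≈₁ ws →
  ∃[ yss ] (ReplaceOne _≈₁_ xss yss × ws ≡ concat yss)
concat-replaceOne⁻ (xs ∷ xss) r with replaceOne-++⁻ xs (concat xss) r
... | inj₁ (xs′ , r′ , refl) = xs′ ∷ xss , here r′ , refl
... | inj₂ (_ , r′ , refl) with yss , rs , refl ← concat-replaceOne⁻ xss r′ = xs ∷ yss , there rs , refl

take-length-++ : ∀ {A : Set} (xs ys : List A) → take (length xs) (xs ++ ys) ≡ xs
take-length-++ []       ys = refl
take-length-++ (x ∷ xs) ys = cong (x ∷_) (take-length-++ xs ys)

drop-length-++ : ∀ {A : Set} (xs ys : List A) → drop (length xs) (xs ++ ys) ≡ ys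
drop-length-++ []       ys = refl
drop-length-++ (x ∷ xs) ys = drop-length-++ xs ys

splitBy-concat : (xss : List (List ℕ)) → splitBy (map length xss) (concat xss) ≡ xss
splitBy-concat []         = refl
splitBy-concat (xs ∷ xss) = cong₂ _∷_ (take-length-++ xs (concat xss))
  (trans (cong (splitBy (map length xss)) (drop-length-++ xs (concat xss))) (splitBy-concat xss))

incFirstMarked-≈₁ : ∀ bs {xs ys} → incFirstMarked bs xs ≡ just ys → xs ≈₁ ys
incFirstMarked-≈₁ (true ∷ bs)  {x ∷ xs} refl = here tt
incFirstMarked-≈₁ (false ∷ bs) {x ∷ xs} eq with incFirstMarked bs xs in eq′
incFirstMarked-≈₁ (false ∷ bs) {x ∷ xs} refl | just _ = there (incFirstMarked-≈₁ bs eq′)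

fWord-≈₁ : ∀ i w {w′} → fWord i w ≡ just w′ → w ≈₁ w′
fWord-≈₁ i w eq with incFirstMarked (reverse (unmatchedMarks i 0 w)) (reverse w) in eq′
fWord-≈₁ i w refl | just v =
  subst (_≈₁ reverse v) (reverse-involutive w) (replaceOne-reverse (incFirstMarked-≈₁ (reverse (unmatchedMarks i 0 w)) eq′))

fTab-replaceOne : ∀ i T {T′} → fTab i T ≡ just T′ → ReplaceOne _≈₁_ T T′
fTab-replaceOne i T eq with fWord i (rw T) in eq′
fTab-replaceOne i T refl | just w
  with Rs′ , rs , refl ← concat-replaceOne⁻ (reverse T) (fWord-≈₁ i (rw T) eq′) =
  subst₂ (ReplaceOne _≈₁_) (reverse-involutive T) (cong reverse (sym splitBy-Rs′)) (replaceOne-reverse rs)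
  where
  splitBy-Rs′ : splitBy (reverse (shapeOf T)) (concat Rs′) ≡ Rs′
  splitBy-Rs′ = begin
    splitBy (reverse (map length T)) (concat Rs′) ≡⟨ cong (λ ls → splitBy ls (concat Rs′)) (reverse-map length T) ⟨
    splitBy (map length (reverse T)) (concat Rs′) ≡⟨ cong (λ ls → splitBy ls (concat Rs′)) (replaceOne⇒map≡ length replaceOne-length rs) ⟩
    splitBy (map length Rs′) (concat Rs′)         ≡⟨ splitBy-concat Rs′ ⟩
    Rs′                                           ∎
    where open ≡-Reasoning

Key : Set
Key = ℕ × ℕ

-- (row, (column, value))
Cell : Set
Cell = ℕ × Key

-- Standardization orders the (column, value) keys by value, ties broken by column.
_≺_ : Key → Key → Set
_≺_ = ×-Lex _≡_ _<_ _<_ on swap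

_≺?_ : ∀ p q → Dec (p ≺ q)
p ≺? q = ×-decidable _≟_ _<?_ _<?_ (swap p) (swap q)

-- stdLabel T c v is rank (cellsCV T) (c , v) by definition.
rank : List Key → Key → ℕ
rank ks q = suc (length (filterᵇ (λ p → does (p ≺? q)) ks))

≺-irrefl : ∀ {q} → ¬ q ≺ q
≺-irrefl = ×-irreflexive {_<₁_ = _<_} {_<₂_ = _<_} <-irrefl <-irrefl (refl , refl)

≺-trans : ∀ {p q r} → p ≺ q → q ≺ r → p ≺ r
≺-trans = ×-transitive {_<₁_ = _<_} {_<₂_ = _<_} isEquivalence <-resp₂-≡ <-trans <-trans

≺-connex : ∀ p q → ¬ p ≺ q → ¬ q ≺ p → p ≡ q
≺-connex (c , v) (c′ , v′) p⊀q q⊀p with ×-compare sym <-cmp <-cmp (v , c) (v′ , c′)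
... | tri< p≺q _ _            = contradiction p≺q p⊀q
... | tri≈ _ (refl , refl) _  = refl
... | tri> _ _ q≺p            = contradiction q≺p q⊀p

T-does⁻ : ∀ {A : Set} (a? : Dec A) → T (does a?) → A
T-does⁻ (yes a) _ = a

T-does⁺ : ∀ {A : Set} (a? : Dec A) → A → T (does a?)
T-does⁺ a? a = subst T (sym (dec-true a? a)) tt

length-filterᵇ-mid : ∀ {A : Set} (f : A → Bool) xs x ys →
  length (filterᵇ f (xs ++ x ∷ ys)) ≡ (if f x then 1 else 0) + length (filterᵇ f (xs ++ ys))
length-filterᵇ-mid f []       x ys with f x
... | true  = refl
... | false = refl
length-filterᵇ-mid f (z ∷ xs) x ys with f z
... | true  = trans (cong suc (length-filterᵇ-mid f xs x ys)) (sym (+-suc _ _))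
... | false = length-filterᵇ-mid f xs x ys

length-filterᵇ-mono : ∀ {A : Set} {f g : A → Bool} → (∀ {x} → T (f x) → T (g x)) →
  ∀ xs → length (filterᵇ f xs) ≤ length (filterᵇ g xs)
length-filterᵇ-mono f⇒g xs = length-mono-≤ (filter⁺ _ _ (λ { refl → f⇒g }) (⊆-refl {x = xs}))

rank-insert-≺ : ∀ P {x} Q {q} → x ≺ q → rank (P ++ x ∷ Q) q ≡ suc (rank (P ++ Q) q)
rank-insert-≺ P {x} Q {q} x≺q = cong suc (trans (length-filterᵇ-mid _ P x Q)
  (cong (λ b → (if b then 1 else 0) + _) (dec-true (x ≺? q) x≺q)))

rank-insert-⊀ : ∀ P {x} Q {q} → ¬ x ≺ q → rank (P ++ x ∷ Q) q ≡ rank (P ++ Q) q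
rank-insert-⊀ P {x} Q {q} x⊀q = cong suc (trans (length-filterᵇ-mid _ P x Q)
  (cong (λ b → (if b then 1 else 0) + _) (dec-false (x ≺? q) x⊀q)))

rank-mono-≤ : ∀ ks {p q} → p ≺ q → rank ks p ≤ rank ks q
rank-mono-≤ ks {p} {q} p≺q = s≤s (length-filterᵇ-mono {f = λ r → does (r ≺? p)} {g = λ r → does (r ≺? q)}
  (λ {r} r≺p → T-does⁺ (r ≺? q) (≺-trans (T-does⁻ (r ≺? p) r≺p) p≺q)) ks)

rank-mono-< : ∀ {ks p q} → p ∈ ks → p ≺ q → rank ks p < rank ks q
rank-mono-< {ks} {p} {q} p∈ks p≺q with P , Q , refl ← ∈-∃++ p∈ks = begin-strict
  rank (P ++ p ∷ Q) p  ≡⟨ rank-insert-⊀ P Q ≺-irrefl ⟩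
  rank (P ++ Q) p      ≤⟨ rank-mono-≤ (P ++ Q) p≺q ⟩
  rank (P ++ Q) q      <⟨ n<1+n _ ⟩
  suc (rank (P ++ Q) q) ≡⟨ rank-insert-≺ P Q p≺q ⟨
  rank (P ++ p ∷ Q) q  ∎
  where open ≤-Reasoning

keys : List Cell → List Key
keys = map proj₂

labels : List Cell → List ℕ
labels C = map (rank (keys C) ∘ proj₂) C

labelCells : List Cell → List (ℕ × ℕ)
labelCells C = map (λ e → proj₁ e , rank (keys C) (proj₂ e)) C

rowOfLabel : ℕ → List (ℕ × ℕ) → ℕ
rowOfLabel k []             = 0
rowOfLabel k ((r , l) ∷ rls) = if l ≡ᵇ k then r else rowOfLabel k rls

rowSequence : List Cell → List ℕ
rowSequence C = map (λ k → rowOfLabel k (labelCells C)) (range 1 (length C))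

rowOfLabel-skip : ∀ {k l} rls r rls′ → l ≢ k → rowOfLabel k (rls ++ (r , l) ∷ rls′) ≡ rowOfLabel k (rls ++ rls′)
rowOfLabel-skip {k} {l} []              r rls′ l≢k rewrite dec-false (l ≟ k) l≢k = refl
rowOfLabel-skip {k}     ((r′ , l′) ∷ rls) r rls′ l≢k =
  cong (if l′ ≡ᵇ k then r′ else_) (rowOfLabel-skip rls r rls′ l≢k)

rowOfLabel-relabel : ∀ (g h : Cell → ℕ) C {k k′} → (∀ {e} → e ∈ C → (g e ≡ᵇ k) ≡ (h e ≡ᵇ k′)) →
  rowOfLabel k (map (λ e → proj₁ e , g e) C) ≡ rowOfLabel k′ (map (λ e → proj₁ e , h e) C)
rowOfLabel-relabel g h []      same = refl
rowOfLabel-relabel g h (e ∷ C) same = cong₂ (λ b t → if b then proj₁ e else t)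
  (same (here refl)) (rowOfLabel-relabel g h C (same ∘ there))

unique-map-mid : ∀ {A : Set} (g : A → ℕ) P x Q → Unique (map g (P ++ x ∷ Q)) →
  ∀ {e} → e ∈ P ++ Q → g x ≢ g e
unique-map-mid g P x Q distinct e∈
  with gx∉ ∷ _ ← Unique-resp-↭ (↭⇒↭ₛ (↭-map⁺ g (shift x P Q))) distinct = All.lookup gx∉ (∈-map⁺ g e∈)

≡ᵇ-both-false : ∀ {m k n k′} → m ≢ k → n ≢ k′ → (m ≡ᵇ k) ≡ (n ≡ᵇ k′)
≡ᵇ-both-false {m} {k} {n} {k′} m≢k n≢k′ = trans (dec-false (m ≟ k) m≢k) (sym (dec-false (n ≟ k′) n≢k′))

rank≤1+length : ∀ ks q → rank ks q ≤ suc (length ks)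
rank≤1+length ks q = s≤s (length-filter _ ks)

-- Removing x lowers by one the labels above the label of x and keeps the others.
module Deletion (P : List Cell) (x : Cell) (Q : List Cell) (distinct : Unique (labels (P ++ x ∷ Q))) where

  private
    rank⁺ rank⁻ : Key → ℕ
    rank⁺ = rank (keys (P ++ x ∷ Q))
    rank⁻ = rank (keys (P ++ Q))

    keys-++ : ∀ R → keys (P ++ R) ≡ keys P ++ keys R
    keys-++ = map-++ proj₂ P

    ∈-mid : ∀ {e} → e ∈ P ++ Q → e ∈ P ++ x ∷ Q
    ∈-mid e∈ = [ ∈-++⁺ˡ , ∈-++⁺ʳ P ∘ there ]′ (∈-++⁻ P e∈)

  rank⁺-≺ : ∀ {q} → proj₂ x ≺ q → rank⁺ q ≡ suc (rank⁻ q)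
  rank⁺-≺ {q} x≺q = begin
    rank (keys (P ++ x ∷ Q)) q          ≡⟨ cong (λ ks → rank ks q) (keys-++ (x ∷ Q)) ⟩
    rank (keys P ++ proj₂ x ∷ keys Q) q ≡⟨ rank-insert-≺ (keys P) (keys Q) x≺q ⟩
    suc (rank (keys P ++ keys Q) q)     ≡⟨ cong (λ ks → suc (rank ks q)) (keys-++ Q) ⟨
    suc (rank (keys (P ++ Q)) q)        ∎
    where open ≡-Reasoning

  rank⁺-⊀ : ∀ {q} → ¬ proj₂ x ≺ q → rank⁺ q ≡ rank⁻ q
  rank⁺-⊀ {q} x⊀q = begin
    rank (keys (P ++ x ∷ Q)) q          ≡⟨ cong (λ ks → rank ks q) (keys-++ (x ∷ Q)) ⟩
    rank (keys P ++ proj₂ x ∷ keys Q) q ≡⟨ rank-insert-⊀ (keys P) (keys Q) x⊀q ⟩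
    rank (keys P ++ keys Q) q           ≡⟨ cong (λ ks → rank ks q) (keys-++ Q) ⟨
    rank (keys (P ++ Q)) q              ∎
    where open ≡-Reasoning

  rank⁺-cases : ∀ {e} → e ∈ P ++ Q →
    (rank⁺ (proj₂ x) < rank⁺ (proj₂ e) × rank⁺ (proj₂ e) ≡ suc (rank⁻ (proj₂ e))) ⊎
    (rank⁺ (proj₂ e) < rank⁺ (proj₂ x) × rank⁺ (proj₂ e) ≡ rank⁻ (proj₂ e))
  rank⁺-cases {e} e∈ with proj₂ x ≺? proj₂ e
  ... | yes x≺e = inj₁ (rank-mono-< (∈-map⁺ proj₂ (∈-++⁺ʳ P (here refl))) x≺e , rank⁺-≺ x≺e)
  ... | no  x⊀e = inj₂ (rank-mono-< (∈-map⁺ proj₂ (∈-mid e∈)) e≺x , rank⁺-⊀ x⊀e)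
    where
    e≺x : proj₂ e ≺ proj₂ x
    e≺x with proj₂ e ≺? proj₂ x
    ... | yes e≺x = e≺x
    ... | no  e⊀x = contradiction (cong rank⁺ (≺-connex _ _ x⊀e e⊀x))
                      (unique-map-mid (rank⁺ ∘ proj₂) P x Q distinct e∈)

  rowOfLabel-delete : ∀ {k k′} → rank⁺ (proj₂ x) ≢ k →
    (∀ {e} → e ∈ P ++ Q → (rank⁺ (proj₂ e) ≡ᵇ k) ≡ (rank⁻ (proj₂ e) ≡ᵇ k′)) →
    rowOfLabel k (labelCells (P ++ x ∷ Q)) ≡ rowOfLabel k′ (labelCells (P ++ Q))
  rowOfLabel-delete {k} {k′} x≢k same = begin
    rowOfLabel k (map φ⁺ (P ++ x ∷ Q))            ≡⟨ cong (rowOfLabel k) (map-++ φ⁺ P (x ∷ Q)) ⟩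
    rowOfLabel k (map φ⁺ P ++ φ⁺ x ∷ map φ⁺ Q)    ≡⟨ rowOfLabel-skip (map φ⁺ P) (proj₁ x) (map φ⁺ Q) x≢k ⟩
    rowOfLabel k (map φ⁺ P ++ map φ⁺ Q)           ≡⟨ cong (rowOfLabel k) (map-++ φ⁺ P Q) ⟨
    rowOfLabel k (map φ⁺ (P ++ Q))                ≡⟨ rowOfLabel-relabel (rank⁺ ∘ proj₂) (rank⁻ ∘ proj₂) (P ++ Q) same ⟩
    rowOfLabel k′ (labelCells (P ++ Q))           ∎
    where
    open ≡-Reasoning
    φ⁺ : Cell → ℕ × ℕ
    φ⁺ e = proj₁ e , rank⁺ (proj₂ e)

  rowOfLabel-below : ∀ {k} → k < rank⁺ (proj₂ x) →
    rowOfLabel k (labelCells (P ++ x ∷ Q)) ≡ rowOfLabel k (labelCells (P ++ Q))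
  rowOfLabel-below {k} k<x = rowOfLabel-delete (>⇒≢ k<x) same
    where
    same : ∀ {e} → e ∈ P ++ Q → (rank⁺ (proj₂ e) ≡ᵇ k) ≡ (rank⁻ (proj₂ e) ≡ᵇ k)
    same e∈ with rank⁺-cases e∈
    ... | inj₁ (x<e , e⁺≡) = ≡ᵇ-both-false (>⇒≢ (<-trans k<x x<e))
                               (>⇒≢ (<-≤-trans k<x (s≤s⁻¹ (subst (rank⁺ (proj₂ x) <_) e⁺≡ x<e))))
    ... | inj₂ (_ , e⁺≡)   = cong (λ r → r ≡ᵇ k) e⁺≡

  rowOfLabel-above : ∀ {k} → rank⁺ (proj₂ x) ≤ k →
    rowOfLabel (suc k) (labelCells (P ++ x ∷ Q)) ≡ rowOfLabel k (labelCells (P ++ Q))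
  rowOfLabel-above {k} x≤k = rowOfLabel-delete (<⇒≢ (s≤s x≤k)) same
    where
    same : ∀ {e} → e ∈ P ++ Q → (rank⁺ (proj₂ e) ≡ᵇ suc k) ≡ (rank⁻ (proj₂ e) ≡ᵇ k)
    same e∈ with rank⁺-cases e∈
    ... | inj₁ (_ , e⁺≡)   = cong (λ r → r ≡ᵇ suc k) e⁺≡
    ... | inj₂ (e<x , e⁺≡) = ≡ᵇ-both-false (<⇒≢ (m<n⇒m<1+n (<-≤-trans e<x x≤k)))
                               (<⇒≢ (subst (_< k) e⁺≡ (<-≤-trans e<x x≤k)))

  rowSequence-delete : ∃[ A ] ∃[ z ] ∃[ B ]
    (rowSequence (P ++ x ∷ Q) ≡ A ++ z ∷ B × rowSequence (P ++ Q) ≡ A ++ B)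
  rowSequence-delete = map f⁺ (range 1 i) , f⁺ (suc i) , map f⁺ (range (2 + i) j) , seq⁺ , seq⁻
    where
    n = length (P ++ Q)
    -- x has label suc i, so the deleted term sits at position suc i
    i = pred (rank⁺ (proj₂ x))
    j = n ∸ i
    f⁺ f⁻ : ℕ → ℕ
    f⁺ k = rowOfLabel k (labelCells (P ++ x ∷ Q))
    f⁻ k = rowOfLabel k (labelCells (P ++ Q))

    i≤n : i ≤ n
    i≤n = s≤s⁻¹ (begin
      rank⁺ (proj₂ x)                ≡⟨ rank⁺-⊀ ≺-irrefl ⟩
      rank⁻ (proj₂ x)                ≤⟨ rank≤1+length (keys (P ++ Q)) (proj₂ x) ⟩
      suc (length (keys (P ++ Q)))   ≡⟨ cong suc (length-map proj₂ (P ++ Q)) ⟩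
      suc n                          ∎)
      where open ≤-Reasoning

    i+j≡n : i + j ≡ n
    i+j≡n = m+[n∸m]≡n i≤n

    seq⁺ : rowSequence (P ++ x ∷ Q) ≡ map f⁺ (range 1 i) ++ f⁺ (suc i) ∷ map f⁺ (range (2 + i) j)
    seq⁺ = begin
      map f⁺ (range 1 (length (P ++ x ∷ Q)))  ≡⟨ cong (map f⁺ ∘ range 1) (trans (length-++-sucʳ P x Q) (cong suc (sym i+j≡n))) ⟩
      map f⁺ (range 1 (suc (i + j)))           ≡⟨ cong (map f⁺ ∘ range 1) (sym (+-suc i j)) ⟩
      map f⁺ (range 1 (i + suc j))             ≡⟨ cong (map f⁺) (range-++ 1 i (suc j)) ⟩
      map f⁺ (range 1 i ++ range (suc i) (suc j)) ≡⟨ map-++ f⁺ (range 1 i) (range (suc i) (suc j)) ⟩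
      map f⁺ (range 1 i) ++ f⁺ (suc i) ∷ map f⁺ (range (2 + i) j) ∎
      where open ≡-Reasoning

    seq⁻ : rowSequence (P ++ Q) ≡ map f⁺ (range 1 i) ++ map f⁺ (range (2 + i) j)
    seq⁻ = begin
      map f⁻ (range 1 n)                             ≡⟨ cong (map f⁻ ∘ range 1) (sym i+j≡n) ⟩
      map f⁻ (range 1 (i + j))                       ≡⟨ cong (map f⁻) (range-++ 1 i j) ⟩
      map f⁻ (range 1 i ++ range (suc i) j)          ≡⟨ map-++ f⁻ (range 1 i) (range (suc i) j) ⟩
      map f⁻ (range 1 i) ++ map f⁻ (range (suc i) j) ≡⟨ cong₂ _++_ below above ⟩
      map f⁺ (range 1 i) ++ map (f⁺ ∘ suc) (range (suc i) j) ≡⟨ cong (map f⁺ (range 1 i) ++_) (trans (map-∘ (range (suc i) j)) (cong (map f⁺) (map-suc-range (suc i) j))) ⟩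
      map f⁺ (range 1 i) ++ map f⁺ (range (2 + i) j) ∎
      where
      open ≡-Reasoning
      below : map f⁻ (range 1 i) ≡ map f⁺ (range 1 i)
      below = map-cong-local (All.tabulate λ k∈ → sym (rowOfLabel-below (proj₂ (∈-range⁻ 1 i k∈))))
      above : map f⁻ (range (suc i) j) ≡ map (f⁺ ∘ suc) (range (suc i) j)
      above = map-cong-local (All.tabulate λ k∈ → sym (rowOfLabel-above (proj₁ (∈-range⁻ (suc i) j k∈))))

cellsFrom : ℕ → Tab → List Cell
cellsFrom r []         = []
cellsFrom r (row ∷ rs) = map (r ,_) (zip (upTo (length row)) row) ++ cellsFrom (suc r) rs

rowEntries : ℕ → Tab → List (ℕ × ℕ)
rowEntries r []         = []
rowEntries r (row ∷ rs) = map (r ,_) row ++ rowEntries (suc r) rs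

keys-cellsFrom : ∀ r T → keys (cellsFrom r T) ≡ cellsCV T
keys-cellsFrom r []         = refl
keys-cellsFrom r (row ∷ rs) = begin
  keys (map (r ,_) cs ++ cellsFrom (suc r) rs)       ≡⟨ map-++ proj₂ (map (r ,_) cs) _ ⟩
  keys (map (r ,_) cs) ++ keys (cellsFrom (suc r) rs) ≡⟨ cong₂ _++_ (trans (sym (map-∘ cs)) (map-id cs)) (keys-cellsFrom (suc r) rs) ⟩
  cs ++ cellsCV rs                                     ∎
  where
  open ≡-Reasoning
  cs = zip (upTo (length row)) row

rowEntries-relabel : ∀ (g : Key → ℕ) r T →
  rowEntries r (map (λ row → map g (zip (upTo (length row)) row)) T) ≡ map (λ e → proj₁ e , g (proj₂ e)) (cellsFrom r T)
rowEntries-relabel g r []         = refl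
rowEntries-relabel g r (row ∷ rs) = begin
  map (r ,_) (map g cs) ++ rowEntries (suc r) (map (λ row → map g (zip (upTo (length row)) row)) rs) ≡⟨ cong₂ _++_ (trans (sym (map-∘ cs)) (map-∘ cs)) (rowEntries-relabel g (suc r) rs) ⟩
  map φ (map (r ,_) cs) ++ map φ (cellsFrom (suc r) rs) ≡⟨ map-++ φ (map (r ,_) cs) (cellsFrom (suc r) rs) ⟨
  map φ (map (r ,_) cs ++ cellsFrom (suc r) rs)         ∎
  where
  open ≡-Reasoning
  cs = zip (upTo (length row)) row
  φ : Cell → ℕ × ℕ
  φ e = proj₁ e , g (proj₂ e)

rowEntries-std : ∀ T → rowEntries 0 (std T) ≡ labelCells (cellsFrom 0 T)
rowEntries-std T = trans (rowEntries-relabel (rank (cellsCV T)) 0 T)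
  (cong (λ ks → map (λ e → proj₁ e , rank ks (proj₂ e)) (cellsFrom 0 T)) (sym (keys-cellsFrom 0 T)))

concat-rowEntries : ∀ r S → concat S ≡ map proj₂ (rowEntries r S)
concat-rowEntries r []         = refl
concat-rowEntries r (row ∷ rs) = begin
  row ++ concat rs                                        ≡⟨ cong₂ _++_ (sym (trans (sym (map-∘ row)) (map-id row))) (concat-rowEntries (suc r) rs) ⟩
  map proj₂ (map (r ,_) row) ++ map proj₂ (rowEntries (suc r) rs) ≡⟨ map-++ proj₂ (map (r ,_) row) _ ⟨
  map proj₂ (map (r ,_) row ++ rowEntries (suc r) rs)     ∎
  where open ≡-Reasoning

rowOfLabel-rowEntries : ∀ r S {k} → k ∈ concat S → rowOfLabel k (rowEntries r S) ≡ r + rowOf k S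
rowOfLabel-rowEntries r ([] ∷ S)       k∈ = trans (rowOfLabel-rowEntries (suc r) S k∈) (sym (+-suc r _))
rowOfLabel-rowEntries r ((x ∷ xs) ∷ S) {k} k∈ with x ≡ᵇ k in x≡ᵇk | k∈
... | true  | _          = sym (+-identityʳ r)
... | false | here refl  = ⊥-elim (subst T x≡ᵇk (≡⇒≡ᵇ x x refl))
... | false | there k∈′  = rowOfLabel-rowEntries r (xs ∷ S) k∈′

≈₁-map : ∀ {A B : Set} (g : A → B) {xs ys} → xs ≈₁ ys → map g xs ≈₁ map g ys
≈₁-map g (here _)  = here tt
≈₁-map g (there r) = there (≈₁-map g r)

≈₁-zip-applyUpTo : ∀ {A : Set} (f : ℕ → ℕ) {xs ys : List A} → xs ≈₁ ys →
  zip (applyUpTo f (length xs)) xs ≈₁ zip (applyUpTo f (length ys)) ys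
≈₁-zip-applyUpTo f (here _)  = here tt
≈₁-zip-applyUpTo f (there r) = there (≈₁-zip-applyUpTo (f ∘ suc) r)

cellsFrom-≈₁ : ∀ r {T T′} → ReplaceOne _≈₁_ T T′ → cellsFrom r T ≈₁ cellsFrom r T′
cellsFrom-≈₁ r (here row≈) = replaceOne-++ˡ _ (≈₁-map (r ,_) (≈₁-zip-applyUpTo (λ c → c) row≈))
cellsFrom-≈₁ r (there T≈)  = replaceOne-++ʳ _ (cellsFrom-≈₁ (suc r) T≈)

module Standardized {sh T} (standard : IsStandard sh (std T)) where

  private
    S = std T
    C = cellsFrom 0 T
    m = sum sh

    perm : concat S ↭ map suc (upTo m)
    perm = proj₂ (proj₂ (proj₂ standard))

    concat≡labels : concat S ≡ labels C
    concat≡labels = begin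
      concat S                          ≡⟨ concat-rowEntries 0 S ⟩
      map proj₂ (rowEntries 0 S)        ≡⟨ cong (map proj₂) (rowEntries-std T) ⟩
      map proj₂ (labelCells C)          ≡⟨ map-∘ C ⟨
      labels C                          ∎
      where open ≡-Reasoning

    length-C : length C ≡ m
    length-C = begin
      length C                   ≡⟨ length-map (rank (keys C) ∘ proj₂) C ⟨
      length (labels C)          ≡⟨ cong length concat≡labels ⟨
      length (concat S)          ≡⟨ ↭-length perm ⟩
      length (map suc (upTo m))  ≡⟨ length-map suc (upTo m) ⟩
      length (upTo m)            ≡⟨ length-applyUpTo (λ c → c) m ⟩
      m                          ∎
      where open ≡-Reasoning

  labels-distinct : Unique (labels C)
  labels-distinct = subst Unique concat≡labels
    (Unique-resp-↭ (↭⇒↭ₛ (↭-sym perm)) (Unique.map⁺ suc-injective (Unique.upTo⁺ m)))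

  numDes-std : numDes S ≡ ascents (rowSequence C)
  numDes-std = begin
    numDes S                                                     ≡⟨ numDes≡ascents S ⟩
    ascents (map (λ k → rowOf k S) (range 1 (cellCount S)))      ≡⟨ cong (λ n → ascents (map (λ k → rowOf k S) (range 1 n))) cellCount≡ ⟩
    ascents (map (λ k → rowOf k S) (range 1 (length C)))         ≡⟨ cong ascents (map-cong-local (All.tabulate rowOf≡)) ⟩
    ascents (rowSequence C)                                      ∎
    where
    open ≡-Reasoning
    cellCount≡ : cellCount S ≡ length C
    cellCount≡ = trans (cong length concat≡labels) (length-map (rank (keys C) ∘ proj₂) C)
    rowOf≡ : ∀ {k} → k ∈ range 1 (length C) → rowOf k S ≡ rowOfLabel k (labelCells C)
    rowOf≡ {k} k∈ = begin
      rowOf k S                      ≡⟨ rowOfLabel-rowEntries 0 S k∈S ⟨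
      rowOfLabel k (rowEntries 0 S)  ≡⟨ cong (rowOfLabel k) (rowEntries-std T) ⟩
      rowOfLabel k (labelCells C)    ∎
      where
      k∈S : k ∈ concat S
      k∈S = ∈-resp-↭ (↭-sym perm) (subst (k ∈_) (sym (map-suc-upTo m)) (subst (λ n → k ∈ range 1 n) length-C k∈))

numDes-std-delete : ∀ {sh T} → IsStandard sh (std T) → ∀ P x Q → cellsFrom 0 T ≡ P ++ x ∷ Q →
  ascents (rowSequence (P ++ Q)) ≤ numDes (std T) × numDes (std T) ≤ suc (ascents (rowSequence (P ++ Q)))
numDes-std-delete {T = T} standard P x Q C≡
  with A , z , B , seq⁺ , seq⁻ ← Deletion.rowSequence-delete P x Q (subst (Unique ∘ labels) C≡ (Standardized.labels-distinct standard)) =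
  subst₂ _≤_ (cong ascents (sym seq⁻)) (sym numDes≡) (ascents-insert-≥ A z B) ,
  subst₂ _≤_ (sym numDes≡) (cong (suc ∘ ascents) (sym seq⁻)) (ascents-insert-≤ A z B)
  where
  open Standardized standard
  numDes≡ : numDes (std T) ≡ ascents (A ++ z ∷ B)
  numDes≡ = trans numDes-std (cong ascents (trans (cong rowSequence C≡) seq⁺))

numDes-std-fTab : ∀ {sh T T′} i → IsStandard sh (std T) → IsStandard sh (std T′) → fTab i T ≡ just T′ →
  numDes (std T) ≤ numDes (std T′) + 1 × numDes (std T′) ≤ numDes (std T) + 1
numDes-std-fTab {T = T} i standard standard′ fT≡
  with P , x , y , Q , C≡ , C′≡ , _ ← replaceOne⁻ (cellsFrom-≈₁ 0 (fTab-replaceOne i T fT≡))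
  with lo , hi ← numDes-std-delete standard P x Q C≡
  with lo′ , hi′ ← numDes-std-delete standard′ P y Q C′≡ =
  ≤-trans hi (≤-trans (s≤s lo′) (≤-reflexive (+-comm 1 _))) ,
  ≤-trans hi′ (≤-trans (s≤s lo) (≤-reflexive (+-comm 1 _)))

skeletonEdge-numDes : ∀ {sh n S S′} → SkeletonEdge sh n S S′ →
  numDes S ≤ numDes S′ + 1 × numDes S′ ≤ numDes S + 1
skeletonEdge-numDes ((standard , _) , (standard′ , _) , _ , T , i , _ , _ , _ , refl , T′ , fT≡ , _ , refl) =
  numDes-std-fTab i standard standard′ fT≡

-- The bound holds for every edge of every Skeleton(sh)_n.
mainTheorem15 : (m : ℕ) (sh : List ℕ) → IsPartition m sh →
    (L : ℕ) → IsMaxDesParts sh L →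
    (S S' : Tab) → (SkeletonEdge sh L S S' ⊎ SkeletonEdge sh L S' S) →
    numDes S ≤ numDes S' + 1 × numDes S' ≤ numDes S + 1
mainTheorem15 m sh _ L _ S S' (inj₁ edge) = skeletonEdge-numDes edge
mainTheorem15 m sh _ L _ S S' (inj₂ edge) = swap (skeletonEdge-numDes edge)
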